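{- Let $q$ be a prime power and $\mathbb{F}_q$ the finite field of order $q$. For $\beta\in\mathbb{F}_q^*$ and $\gamma\in\mathbb{F}_q$ let $P_{\beta,\gamma}$ be the $q\times q$ $(0,1)$-matrix with rows and columns indexed by $\mathbb{F}_q$ whose $(a,b)$-entry is $1$ if and only if $\beta(-a+b)=\gamma$. Then: (i) for $\beta,\beta'\in\mathbb{F}_q^*$ and $\gamma\in\mathbb{F}_q$, $P_{\beta\beta',\gamma\beta'}=P_{\beta,\gamma}$; (ii) for $\beta,\beta'\in\mathbb{F}_q^*$ and $\gamma,\gamma'\in\mathbb{F}_q$, $P_{\beta,\gamma}P_{\beta',\gamma'}=P_{\beta\beta',\beta\gamma'+\beta'\gamma}$; (iii) for $\beta,\beta'\in\mathbb{F}_q^*$, $\sum_{\gamma\in\mathbb{F}_q}P_{\beta\beta',(\beta+\beta')\gamma}$ equals $qI_q$ if $\beta+\beta'=0$ and equals $J_q$ if $\beta+\beta'\neq 0$; (iv) for $\beta,\beta'\in\mathbb{F}_q^*$, $\sum_{\gamma,\gamma'\in\mathbb{F}_q^*,\ \gamma\neq\gamma'}P_{\beta\beta',\beta\gamma'+\beta'\gamma}$ equals $(q-2)(J_q-I_q)$ if $\beta+\beta'=0$ and equals $2I_q+(q-3)J_q$ if $\beta+\beta'\neq 0$.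
   Context: $I_n$ and $J_n$ denote the identity matrix and the all-ones matrix of order $n$; $\mathbb{F}_q^*=\mathbb{F}_q\setminus\{0\}$. -}

module Defs where

open import Level using (0ℓ)
open import Data.Nat using (ℕ)
open import Data.Product using (∃)
open import Data.List using (List; map; filter; length; foldr)
open import Data.List.Membership.Propositional using (_∈_)
open import Data.List.Relation.Unary.Unique.Propositional using (Unique)
open import Data.Integer as ℤ using (ℤ; +_)
open import Relation.Nullary using (¬_; yes; no; ¬?)
open import Relation.Binary using (DecidableEquality)
open import Relation.Binary.PropositionalEquality using (_≡_)
open import Algebra.Structures using (IsCommutativeRing)

record FiniteField : Set₁ where
  infixl 6 _+_
  infixl 7 _*_
  field
    Carrier : Set
    _+_ _*_ : Carrier → Carrier → Carrier
    -_ : Carrier → Carrier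
    0# 1# : Carrier
    isCommutativeRing : IsCommutativeRing _≡_ _+_ _*_ -_ 0# 1#
    0≢1 : ¬ (0# ≡ 1#)
    inverse : ∀ x → ¬ (x ≡ 0#) → ∃ λ y → x * y ≡ 1#
    _≟_ : DecidableEquality Carrier
    elements : List Carrier
    complete : ∀ x → x ∈ elements
    unique : Unique elements

  order : ℕ
  order = length elements

  nonzero : List Carrier
  nonzero = filter (λ x → ¬? (x ≟ 0#)) elements

module _ (F : FiniteField) where
  open FiniteField F

  Mat : Set
  Mat = Carrier → Carrier → ℤ

  _≐_ : Mat → Mat → Set
  A ≐ B = ∀ a b → A a b ≡ B a b

  sumℤ : List ℤ → ℤ
  sumℤ = foldr ℤ._+_ (+ 0)

  _·_ : Mat → Mat → Mat
  (A · B) a b = sumℤ (map (λ c → A a c ℤ.* B c b) elements)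

  _⊕_ : Mat → Mat → Mat
  (A ⊕ B) a b = A a b ℤ.+ B a b

  _⊛_ : ℤ → Mat → Mat
  (k ⊛ A) a b = k ℤ.* A a b

  ΣM : {I : Set} → List I → (I → Mat) → Mat
  ΣM is f a b = sumℤ (map (λ i → f i a b) is)

  Id : Mat
  Id a b with a ≟ b
  ... | yes _ = + 1
  ... | no  _ = + 0

  Jm : Mat
  Jm a b = + 1

  zeroM : Mat
  zeroM a b = + 0

  P : Carrier → Carrier → Mat
  P β γ a b with (β * (- a + b)) ≟ γ
  ... | yes _ = + 1
  ... | no  _ = + 0

module Submission where

-- Every entry of every matrix in the statement is a sum of indicators
-- (Iverson brackets) of linear equations over the field F.

open import Level using (0ℓ)
open import Defs
open import Data.Product using (_×_; _,_; proj₁; proj₂)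
open import Data.Product.Function.NonDependent.Propositional using (_×-⇔_)
open import Data.List using (List; []; _∷_; filter; map; length; foldr)
open import Data.List.Membership.Propositional using (_∈_)
open import Data.List.Relation.Unary.Any using (here; there)
open import Data.List.Relation.Unary.All as All using (All; []; _∷_; all?)
open import Data.List.Relation.Unary.AllPairs using ([]; _∷_)
open import Data.List.Relation.Unary.Unique.Propositional using (Unique)
open import Data.Integer using (ℤ; +_; _-_; -[1+_])
import Data.Integer as ℤ
import Data.Integer.Properties as ℤP
open import Data.Integer.Tactic.RingSolver using (solve-∀)
open import Data.Empty using (⊥-elim)
open import Function.Bundles using (_⇔_; mk⇔; module Equivalence)
import Function.Properties.Equivalence as ⇔
open import Function.Related.TypeIsomorphisms using (¬-cong-⇔)
open import Relation.Nullary using (¬_; ¬?; Dec; yes; no)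
open import Relation.Nullary.Decidable using (_×-dec_)
open import Relation.Binary using (DecidableEquality)
open import Relation.Binary.PropositionalEquality
  using (_≡_; _≢_; refl; sym; trans; cong; cong₂; module ≡-Reasoning)
import Relation.Binary.Reasoning.Setoid as SetoidReasoning
open import Algebra.Bundles using (CommutativeRing)
import Algebra.Properties.Group as GroupProperties
import Algebra.Solver.Ring.NaturalCoefficients.Default as NaturalSolver

module ⇔-Reasoning = SetoidReasoning (⇔.⇔-setoid 0ℓ)

≡-⇔ : {A : Set} {x x' y y' : A} → x ≡ x' → y ≡ y' → (x ≡ y ⇔ x' ≡ y')
≡-⇔ refl refl = ⇔.refl

≡-sym⇔ : {A : Set} {x y : A} → (x ≡ y ⇔ y ≡ x)
≡-sym⇔ = mk⇔ sym sym

𝟙 : {P : Set} → Dec P → ℤ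
𝟙 (yes _) = + 1
𝟙 (no _)  = + 0

𝟙-yes : {P : Set} → P → (P? : Dec P) → 𝟙 P? ≡ + 1
𝟙-yes p (yes _) = refl
𝟙-yes p (no ¬p) = ⊥-elim (¬p p)

𝟙-no : {P : Set} → ¬ P → (P? : Dec P) → 𝟙 P? ≡ + 0
𝟙-no ¬p (yes p) = ⊥-elim (¬p p)
𝟙-no ¬p (no _)  = refl

𝟙-cong : {P Q : Set} → P ⇔ Q → (P? : Dec P) (Q? : Dec Q) → 𝟙 P? ≡ 𝟙 Q?
𝟙-cong P⇔Q (yes p) Q? = sym (𝟙-yes (Equivalence.to P⇔Q p) Q?)
𝟙-cong P⇔Q (no ¬p) Q? = sym (𝟙-no (λ q → ¬p (Equivalence.from P⇔Q q)) Q?)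

𝟙-× : {P Q : Set} (P? : Dec P) (Q? : Dec Q) → 𝟙 P? ℤ.* 𝟙 Q? ≡ 𝟙 (P? ×-dec Q?)
𝟙-× (yes _) (yes _) = refl
𝟙-× (yes _) (no _)  = refl
𝟙-× (no _)  (yes _) = refl
𝟙-× (no _)  (no _)  = refl

-- The sum of an integer-valued function over a list; the matrix products and
-- matrix sums of Defs unfold to exactly this.
∑ : {A : Set} → List A → (A → ℤ) → ℤ
∑ xs f = foldr ℤ._+_ (+ 0) (map f xs)

∑-cong : {A : Set} (xs : List A) {f g : A → ℤ} → (∀ x → f x ≡ g x) → ∑ xs f ≡ ∑ xs g
∑-cong []       f≗g = refl
∑-cong (x ∷ xs) f≗g = cong₂ ℤ._+_ (f≗g x) (∑-cong xs f≗g)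

∑-+ : {A : Set} (xs : List A) (f g : A → ℤ) → ∑ xs (λ x → f x ℤ.+ g x) ≡ ∑ xs f ℤ.+ ∑ xs g
∑-+ []       f g = refl
∑-+ (x ∷ xs) f g = trans (cong (λ s → (f x ℤ.+ g x) ℤ.+ s) (∑-+ xs f g)) (interchange (f x) (g x) (∑ xs f) (∑ xs g))
  where
  interchange : ∀ a b c d → (a ℤ.+ b) ℤ.+ (c ℤ.+ d) ≡ (a ℤ.+ c) ℤ.+ (b ℤ.+ d)
  interchange = solve-∀

∑-const : {A : Set} (xs : List A) (k : ℤ) → ∑ xs (λ _ → k) ≡ + length xs ℤ.* k
∑-const []       k = sym (ℤP.*-zeroˡ k)
∑-const (x ∷ xs) k = trans (cong (λ s → k ℤ.+ s) (∑-const xs k)) (one-more k (+ length xs))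
  where
  one-more : ∀ k n → k ℤ.+ n ℤ.* k ≡ (+ 1 ℤ.+ n) ℤ.* k
  one-more = solve-∀

∑-filter : {A : Set} {Q : A → Set} (Q? : ∀ x → Dec (Q x)) (xs : List A) (f : A → ℤ) →
  ∑ (filter Q? xs) f ≡ ∑ xs (λ x → 𝟙 (Q? x) ℤ.* f x)
∑-filter Q? []       f = refl
∑-filter Q? (x ∷ xs) f with Q? x
... | yes _ = cong₂ ℤ._+_ (sym (ℤP.*-identityˡ (f x))) (∑-filter Q? xs f)
... | no _  = trans (∑-filter Q? xs f) (sym (trans (cong (λ t → t ℤ.+ rest) (ℤP.*-zeroˡ (f x))) (ℤP.+-identityˡ rest)))
  where
  rest : ℤ
  rest = ∑ xs (λ y → 𝟙 (Q? y) ℤ.* f y)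

module DeltaSums {A : Set} (_≟_ : DecidableEquality A) where

  ∑-δ-absent : ∀ {x₀ : A} (g : A → ℤ) (xs : List A) → ¬ (x₀ ∈ xs) →
    ∑ xs (λ x → 𝟙 (x ≟ x₀) ℤ.* g x) ≡ + 0
  ∑-δ-absent g []       _    = refl
  ∑-δ-absent g (x ∷ xs) x₀∉ =
    cong₂ ℤ._+_ (cong (ℤ._* g x) (𝟙-no (λ { refl → x₀∉ (here refl) }) (x ≟ _)))
                (∑-δ-absent g xs (λ x₀∈ → x₀∉ (there x₀∈)))

  ∑-δ : ∀ {x₀ : A} (g : A → ℤ) {xs : List A} → Unique xs → x₀ ∈ xs →
    ∑ xs (λ x → 𝟙 (x ≟ x₀) ℤ.* g x) ≡ g x₀
  ∑-δ g {x ∷ xs} (x∉xs ∷ _) (here refl) =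
    trans (cong₂ ℤ._+_ (cong (ℤ._* g x) (𝟙-yes refl (x ≟ x)))
                       (∑-δ-absent g xs (λ x∈ → All.lookup x∉xs x∈ refl)))
          (trans (ℤP.+-identityʳ _) (ℤP.*-identityˡ (g x)))
  ∑-δ g {x ∷ xs} (x∉xs ∷ unique) (there x₀∈) =
    trans (cong₂ ℤ._+_ (cong (ℤ._* g x) (𝟙-no (λ { refl → All.lookup x∉xs x₀∈ refl }) (x ≟ _)))
                       (∑-δ g unique x₀∈))
          (ℤP.+-identityˡ _)

  ∑-δ1 : ∀ {x₀ : A} {xs : List A} → Unique xs → x₀ ∈ xs → ∑ xs (λ x → 𝟙 (x ≟ x₀)) ≡ + 1
  ∑-δ1 {x₀} {xs} unique x₀∈ =
    trans (∑-cong xs (λ x → sym (ℤP.*-identityʳ (𝟙 (x ≟ x₀))))) (∑-δ (λ _ → + 1) unique x₀∈)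

  avoids? : (x : A) (ps : List A) → Dec (All (x ≢_) ps)
  avoids? x ps = all? (λ p → ¬? (x ≟ p)) ps

  avoids-cons : ∀ {p : A} {ps : List A} → All (p ≢_) ps → ∀ x →
    𝟙 (avoids? x (p ∷ ps)) ℤ.+ 𝟙 (x ≟ p) ≡ 𝟙 (avoids? x ps)
  avoids-cons {p} {ps} p∉ps x = by-cases (x ≟ p)
    where
    by-cases : Dec (x ≡ p) → 𝟙 (avoids? x (p ∷ ps)) ℤ.+ 𝟙 (x ≟ p) ≡ 𝟙 (avoids? x ps)
    by-cases (yes x≡p) =
      trans (cong₂ ℤ._+_ (𝟙-no (λ { (x≢p ∷ _) → x≢p x≡p }) (avoids? x (p ∷ ps))) (𝟙-yes x≡p (x ≟ p)))
            (sym (𝟙-yes (All.map (λ p≢y x≡y → p≢y (trans (sym x≡p) x≡y)) p∉ps) (avoids? x ps)))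
    by-cases (no x≢p) =
      trans (cong₂ ℤ._+_ (𝟙-cong (mk⇔ (λ { (_ ∷ x∉ps) → x∉ps }) (x≢p ∷_)) (avoids? x (p ∷ ps)) (avoids? x ps)) (𝟙-no x≢p (x ≟ p)))
            (ℤP.+-identityʳ _)

  count-avoiding : ∀ {xs ps : List A} → Unique xs → Unique ps → All (_∈ xs) ps →
    ∑ xs (λ x → 𝟙 (avoids? x ps)) ≡ + length xs - + length ps
  count-avoiding {xs} {[]} _ _ _ =
    trans (∑-const xs (+ 1)) (trans (ℤP.*-identityʳ (+ length xs)) (sym (ℤP.+-identityʳ (+ length xs))))
  count-avoiding {xs} {p ∷ ps} uxs (p∉ps ∷ ups) (p∈xs ∷ ps⊆xs) = begin
      avoiding (p ∷ ps)
    ≡⟨ add-sub (avoiding (p ∷ ps)) ⟩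
      (avoiding (p ∷ ps) ℤ.+ + 1) - + 1
    ≡⟨ cong (_- + 1) one-fewer ⟩
      (+ length xs - + length ps) - + 1
    ≡⟨ sub-sub (+ length xs) (+ length ps) ⟩
      + length xs - + length (p ∷ ps) ∎
    where
    open ≡-Reasoning
    avoiding : List A → ℤ
    avoiding qs = ∑ xs (λ x → 𝟙 (avoids? x qs))
    one-fewer : avoiding (p ∷ ps) ℤ.+ + 1 ≡ + length xs - + length ps
    one-fewer = begin
        avoiding (p ∷ ps) ℤ.+ + 1
      ≡⟨ cong (λ t → avoiding (p ∷ ps) ℤ.+ t) (∑-δ1 uxs p∈xs) ⟨
        avoiding (p ∷ ps) ℤ.+ ∑ xs (λ x → 𝟙 (x ≟ p))
      ≡⟨ ∑-+ xs _ _ ⟨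
        ∑ xs (λ x → 𝟙 (avoids? x (p ∷ ps)) ℤ.+ 𝟙 (x ≟ p))
      ≡⟨ ∑-cong xs (avoids-cons p∉ps) ⟩
        avoiding ps
      ≡⟨ count-avoiding uxs ups ps⊆xs ⟩
        + length xs - + length ps ∎
    add-sub : ∀ y → y ≡ (y ℤ.+ + 1) - + 1
    add-sub = solve-∀
    sub-sub : ∀ n m → (n - m) - + 1 ≡ n - (+ 1 ℤ.+ m)
    sub-sub = solve-∀

module FieldAlgebra (F : FiniteField) where
  open FiniteField F
  open DeltaSums _≟_ public

  ring : CommutativeRing 0ℓ 0ℓ
  ring = record { isCommutativeRing = isCommutativeRing }

  open CommutativeRing ring
    using (+-group; commutativeSemiring; *-assoc; *-comm; *-identityˡ; zeroʳ; +-assoc; +-identityʳ)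
  open GroupProperties +-group
    using (\\-leftDividesˡ; \\-leftDividesʳ; //-rightDividesˡ; //-rightDividesʳ)
  open NaturalSolver commutativeSemiring using (solve; _:+_; _:*_; _:=_)

  inv : (x : Carrier) → x ≢ 0# → Carrier
  inv x x≢0 = proj₁ (inverse x x≢0)

  divide⇔ : ∀ {x y c} (x≢0 : x ≢ 0#) → (x * y ≡ c ⇔ y ≡ inv x x≢0 * c)
  divide⇔ {x} {y} {c} x≢0 = mk⇔ solution check
    where
    open ≡-Reasoning
    x⁻¹ : Carrier
    x⁻¹ = inv x x≢0
    x*x⁻¹≡1 : x * x⁻¹ ≡ 1#
    x*x⁻¹≡1 = proj₂ (inverse x x≢0)
    solution : x * y ≡ c → y ≡ x⁻¹ * c
    solution refl = begin
      y                ≡⟨ *-identityˡ y ⟨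
      1# * y           ≡⟨ cong (_* y) x*x⁻¹≡1 ⟨
      (x * x⁻¹) * y    ≡⟨ cong (_* y) (*-comm x x⁻¹) ⟩
      (x⁻¹ * x) * y    ≡⟨ *-assoc x⁻¹ x y ⟩
      x⁻¹ * (x * y)    ∎
    check : y ≡ x⁻¹ * c → x * y ≡ c
    check refl = begin
      x * (x⁻¹ * c)    ≡⟨ *-assoc x x⁻¹ c ⟨
      (x * x⁻¹) * c    ≡⟨ cong (_* c) x*x⁻¹≡1 ⟩
      1# * c           ≡⟨ *-identityˡ c ⟩
      c                ∎

  *-cancel⇔ : ∀ {x y z} → x ≢ 0# → (x * y ≡ x * z ⇔ y ≡ z)
  *-cancel⇔ x≢0 = mk⇔ (λ e → trans (Equivalence.to (divide⇔ x≢0) e) (sym (Equivalence.to (divide⇔ x≢0) refl)))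
                       (cong (_ *_))

  mul-zero⇔ : ∀ {x y} → x ≢ 0# → (x * y ≡ 0# ⇔ y ≡ 0#)
  mul-zero⇔ {x} x≢0 = ⇔.trans (≡-⇔ refl (sym (zeroʳ x))) (*-cancel⇔ x≢0)

  *-nonzero : ∀ {x y} → x ≢ 0# → y ≢ 0# → x * y ≢ 0#
  *-nonzero x≢0 y≢0 xy≡0 = y≢0 (Equivalence.to (mul-zero⇔ x≢0) xy≡0)

  subtract⇔ : ∀ {y z c} → (y + z ≡ c ⇔ y ≡ c + - z)
  subtract⇔ {y} {z} = mk⇔ (λ { refl → sym (//-rightDividesʳ z y) }) (λ { refl → //-rightDividesˡ z _ })

  +-cancel⇔ : ∀ {y y' z} → (y + z ≡ y' + z ⇔ y ≡ y')
  +-cancel⇔ {y' = y'} {z} = ⇔.trans subtract⇔ (≡-⇔ refl (//-rightDividesʳ z y'))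

  linear⇔ : ∀ {x y z c} (x≢0 : x ≢ 0#) → (x * y + z ≡ c ⇔ y ≡ inv x x≢0 * (c + - z))
  linear⇔ x≢0 = ⇔.trans subtract⇔ (divide⇔ x≢0)

  Δ : Carrier → Carrier → Carrier
  Δ a b = - a + b

  Δ⇔ : ∀ {a b e} → (Δ a b ≡ e ⇔ b ≡ a + e)
  Δ⇔ {a} {b} = mk⇔ (λ { refl → sym (\\-leftDividesˡ a b) }) (λ { refl → \\-leftDividesʳ a _ })

  Δ-zero⇔ : ∀ {a b} → (Δ a b ≡ 0# ⇔ a ≡ b)
  Δ-zero⇔ {a} = ⇔.trans Δ⇔ (⇔.trans (≡-⇔ refl (+-identityʳ a)) ≡-sym⇔)

  Δ-chasles : ∀ a c b → Δ a c + Δ c b ≡ Δ a b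
  Δ-chasles a c b = trans (+-assoc (- a) c (Δ c b)) (cong (λ t → - a + t) (\\-leftDividesˡ c b))

  bilinear : ∀ β β' x y → β * (β' * y) + β' * (β * x) ≡ (β * β') * (x + y)
  bilinear = solve 4 (λ β β' x y → β :* (β' :* y) :+ β' :* (β :* x) := (β :* β') :* (x :+ y)) refl

module PMatrices (F : FiniteField) where
  open FiniteField F
  open FieldAlgebra F
  open CommutativeRing ring using (*-comm; *-assoc; zeroˡ; zeroʳ; +-identityˡ; distribʳ)

  P-𝟙 : ∀ β γ a b → P F β γ a b ≡ 𝟙 ((β * Δ a b) ≟ γ)
  P-𝟙 β γ a b with (β * Δ a b) ≟ γ
  ... | yes _ = refl
  ... | no _  = refl

  P-entry : ∀ {β γ a b} {Q : Set} (Q? : Dec Q) → (β * Δ a b ≡ γ ⇔ Q) → P F β γ a b ≡ 𝟙 Q?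
  P-entry {β} {γ} {a} {b} Q? e = trans (P-𝟙 β γ a b) (𝟙-cong e ((β * Δ a b) ≟ γ) Q?)

  P-cong : ∀ {β γ a b β' γ' a' b'} → (β * Δ a b ≡ γ ⇔ β' * Δ a' b' ≡ γ') →
    P F β γ a b ≡ P F β' γ' a' b'
  P-cong {β' = β'} {γ'} {a'} {b'} e = trans (P-entry ((β' * Δ a' b') ≟ γ') e) (sym (P-𝟙 β' γ' a' b'))

  Id-𝟙 : ∀ a b → Id F a b ≡ 𝟙 (a ≟ b)
  Id-𝟙 a b with a ≟ b
  ... | yes _ = refl
  ... | no _  = refl

  part-i : ∀ β β' γ → β ≢ 0# → β' ≢ 0# → _≐_ F (P F (β * β') (γ * β')) (P F β γ)
  part-i β β' γ _ β'≢0 a b = P-cong (begin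
      (β * β') * Δ a b ≡ γ * β'    ≈⟨ ≡-⇔ reorder (*-comm γ β') ⟩
      β' * (β * Δ a b) ≡ β' * γ    ≈⟨ *-cancel⇔ β'≢0 ⟩
      β * Δ a b ≡ γ                ∎)
    where
    open ⇔-Reasoning
    reorder : (β * β') * Δ a b ≡ β' * (β * Δ a b)
    reorder = trans (cong (_* Δ a b) (*-comm β β')) (*-assoc β' β (Δ a b))

  -- (ii) In (P_{β,γ} P_{β',γ'})_{a,b} only the unique c with β (c - a) = γ
  -- contributes, and there β' (b - c) = γ' is equivalent to the defining
  -- equation of P_{ββ', βγ' + β'γ} because Δ a b = Δ a c + Δ c b.
  part-ii : ∀ β β' γ γ' → β ≢ 0# → β' ≢ 0# →
    _≐_ F (_·_ F (P F β γ) (P F β' γ')) (P F (β * β') (β * γ' + β' * γ))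
  part-ii β β' γ γ' β≢0 _ a b = begin
      ∑ elements (λ c → P F β γ a c ℤ.* P F β' γ' c b)
    ≡⟨ ∑-cong elements (λ c → cong (ℤ._* P F β' γ' c b) (P-entry (c ≟ c₀) (at-c₀ c))) ⟩
      ∑ elements (λ c → 𝟙 (c ≟ c₀) ℤ.* P F β' γ' c b)
    ≡⟨ ∑-δ (λ c → P F β' γ' c b) unique (complete c₀) ⟩
      P F β' γ' c₀ b
    ≡⟨ P-cong through-c₀ ⟩
      P F (β * β') (β * γ' + β' * γ) a b ∎
    where
    open ≡-Reasoning
    c₀ : Carrier
    c₀ = a + inv β β≢0 * γ
    at-c₀ : ∀ c → (β * Δ a c ≡ γ ⇔ c ≡ c₀)
    at-c₀ c = ⇔.trans (divide⇔ β≢0) Δ⇔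
    split : β * (β' * Δ c₀ b) + β' * γ ≡ (β * β') * Δ a b
    split = begin
        β * (β' * Δ c₀ b) + β' * γ
      ≡⟨ cong (λ g → β * (β' * Δ c₀ b) + β' * g) (Equivalence.from (at-c₀ c₀) refl) ⟨
        β * (β' * Δ c₀ b) + β' * (β * Δ a c₀)
      ≡⟨ bilinear β β' (Δ a c₀) (Δ c₀ b) ⟩
        (β * β') * (Δ a c₀ + Δ c₀ b)
      ≡⟨ cong ((β * β') *_) (Δ-chasles a c₀ b) ⟩
        (β * β') * Δ a b ∎
    through-c₀ : (β' * Δ c₀ b ≡ γ') ⇔ ((β * β') * Δ a b ≡ β * γ' + β' * γ)
    through-c₀ = ⇔.trans (⇔.sym (*-cancel⇔ β≢0)) (⇔.trans (⇔.sym +-cancel⇔) (≡-⇔ split refl))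

  sum-kills : ∀ {β β'} → β + β' ≡ 0# → ∀ γ → (β + β') * γ ≡ 0#
  sum-kills s≡0 γ = trans (cong (_* γ) s≡0) (zeroˡ γ)

  -- (iii), β + β' = 0: every term says (ββ')(b - a) = 0, i.e. a = b.
  part-iii-zero : ∀ β β' → β ≢ 0# → β' ≢ 0# → β + β' ≡ 0# →
    _≐_ F (ΣM F elements (λ γ → P F (β * β') ((β + β') * γ))) (_⊛_ F (+ order) (Id F))
  part-iii-zero β β' β≢0 β'≢0 s≡0 a b = begin
      ∑ elements (λ γ → P F (β * β') ((β + β') * γ) a b)
    ≡⟨ ∑-cong elements (λ γ → P-entry (a ≟ b) (diagonal γ)) ⟩
      ∑ elements (λ _ → 𝟙 (a ≟ b))
    ≡⟨ ∑-const elements (𝟙 (a ≟ b)) ⟩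
      + order ℤ.* 𝟙 (a ≟ b)
    ≡⟨ cong (λ i → + order ℤ.* i) (Id-𝟙 a b) ⟨
      + order ℤ.* Id F a b ∎
    where
    open ≡-Reasoning
    diagonal : ∀ γ → ((β * β') * Δ a b ≡ (β + β') * γ ⇔ a ≡ b)
    diagonal γ = ⇔.trans (≡-⇔ refl (sum-kills s≡0 γ))
                         (⇔.trans (mul-zero⇔ (*-nonzero β≢0 β'≢0)) Δ-zero⇔)

  -- (iii), β + β' ≠ 0: exactly one γ solves (β + β') γ = (ββ')(b - a).
  part-iii-nonzero : ∀ β β' → β ≢ 0# → β' ≢ 0# → ¬ (β + β' ≡ 0#) →
    _≐_ F (ΣM F elements (λ γ → P F (β * β') ((β + β') * γ))) (Jm F)
  part-iii-nonzero β β' _ _ s≢0 a b = begin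
      ∑ elements (λ γ → P F (β * β') ((β + β') * γ) a b)
    ≡⟨ ∑-cong elements (λ γ → P-entry (γ ≟ γ₀) (⇔.trans ≡-sym⇔ (divide⇔ s≢0))) ⟩
      ∑ elements (λ γ → 𝟙 (γ ≟ γ₀))
    ≡⟨ ∑-δ1 unique (complete γ₀) ⟩
      + 1 ∎
    where
    open ≡-Reasoning
    γ₀ : Carrier
    γ₀ = inv (β + β') s≢0 * ((β * β') * Δ a b)

  -- (iv) Fix β, β' and an entry (a, b); write D = (ββ')(b - a).  The entry
  -- counts pairs γ ≠ γ' of nonzero elements with β γ' + β' γ = D.  For each γ
  -- there is exactly one candidate γ' = w γ, so the entry counts the "good" γ:
  -- those with γ ≠ 0, w γ ≠ 0 and w γ ≠ γ.  The good γ are exactly the γ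
  -- avoiding a duplicate-free list of forbidden values, chosen per case.
  module PairCount (β β' : Carrier) (β≢0 : β ≢ 0#) (β'≢0 : β' ≢ 0#) (a b : Carrier) where

    D : Carrier
    D = (β * β') * Δ a b

    D≡0⇔ : D ≡ 0# ⇔ a ≡ b
    D≡0⇔ = ⇔.trans (mul-zero⇔ (*-nonzero β≢0 β'≢0)) Δ-zero⇔

    w : Carrier → Carrier
    w γ = inv β β≢0 * (D + - (β' * γ))

    on-line : ∀ γ γ' → (β * γ' + β' * γ ≡ D ⇔ γ' ≡ w γ)
    on-line γ γ' = linear⇔ β≢0

    -- w γ = 0 exactly when γ = u
    u : Carrier
    u = inv β' β'≢0 * D

    at-u : ∀ γ → (β' * γ ≡ D ⇔ γ ≡ u)
    at-u γ = divide⇔ β'≢0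

    w≡0⇔ : ∀ γ → (w γ ≡ 0# ⇔ γ ≡ u)
    w≡0⇔ γ = begin
      w γ ≡ 0#               ≈⟨ ≡-sym⇔ ⟩
      0# ≡ w γ               ≈⟨ on-line γ 0# ⟨
      β * 0# + β' * γ ≡ D    ≈⟨ ≡-⇔ (trans (cong (λ t → t + β' * γ) (zeroʳ β)) (+-identityˡ (β' * γ))) refl ⟩
      β' * γ ≡ D             ≈⟨ at-u γ ⟩
      γ ≡ u                  ∎
      where open ⇔-Reasoning

    fixed⇔ : ∀ γ → (γ ≡ w γ ⇔ (β + β') * γ ≡ D)
    fixed⇔ γ = ⇔.trans (⇔.sym (on-line γ γ)) (≡-⇔ (sym (distribʳ γ β β')) refl)

    good? : (γ : Carrier) → Dec (γ ≢ 0# × (w γ ≢ 0# × γ ≢ w γ))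
    good? γ = ¬? (γ ≟ 0#) ×-dec (¬? (w γ ≟ 0#) ×-dec ¬? (γ ≟ w γ))

    inner : ∀ γ → ∑ (filter (λ γ' → ¬? (γ ≟ γ')) nonzero) (λ γ' → P F (β * β') (β * γ' + β' * γ) a b)
                  ≡ 𝟙 (¬? (w γ ≟ 0#) ×-dec ¬? (γ ≟ w γ))
    inner γ = begin
        ∑ (filter R? (filter N? elements)) (λ γ' → P F (β * β') (β * γ' + β' * γ) a b)
      ≡⟨ ∑-cong (filter R? (filter N? elements)) entry ⟩
        ∑ (filter R? (filter N? elements)) (λ γ' → 𝟙 (γ' ≟ w γ))
      ≡⟨ ∑-filter R? (filter N? elements) _ ⟩
        ∑ (filter N? elements) (λ γ' → 𝟙 (R? γ') ℤ.* 𝟙 (γ' ≟ w γ))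
      ≡⟨ ∑-filter N? elements _ ⟩
        ∑ elements (λ γ' → 𝟙 (N? γ') ℤ.* (𝟙 (R? γ') ℤ.* 𝟙 (γ' ≟ w γ)))
      ≡⟨ ∑-cong elements (λ γ' → rotate (𝟙 (N? γ')) (𝟙 (R? γ')) (𝟙 (γ' ≟ w γ))) ⟩
        ∑ elements (λ γ' → 𝟙 (γ' ≟ w γ) ℤ.* (𝟙 (N? γ') ℤ.* 𝟙 (R? γ')))
      ≡⟨ ∑-δ (λ γ' → 𝟙 (N? γ') ℤ.* 𝟙 (R? γ')) unique (complete (w γ)) ⟩
        𝟙 (N? (w γ)) ℤ.* 𝟙 (R? (w γ))
      ≡⟨ 𝟙-× (N? (w γ)) (R? (w γ)) ⟩
        𝟙 (N? (w γ) ×-dec R? (w γ)) ∎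
      where
      open ≡-Reasoning
      N? : (x : Carrier) → Dec (x ≢ 0#)
      N? x = ¬? (x ≟ 0#)
      R? : (γ' : Carrier) → Dec (γ ≢ γ')
      R? γ' = ¬? (γ ≟ γ')
      entry : ∀ γ' → P F (β * β') (β * γ' + β' * γ) a b ≡ 𝟙 (γ' ≟ w γ)
      entry γ' = P-entry (γ' ≟ w γ) (⇔.trans ≡-sym⇔ (on-line γ γ'))
      rotate : ∀ x y z → x ℤ.* (y ℤ.* z) ≡ z ℤ.* (x ℤ.* y)
      rotate = solve-∀

    double-sum : ΣM F nonzero (λ γ → ΣM F (filter (λ γ' → ¬? (γ ≟ γ')) nonzero)
                   (λ γ' → P F (β * β') (β * γ' + β' * γ))) a b
                 ≡ ∑ elements (λ γ → 𝟙 (good? γ))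
    double-sum = begin
        ∑ nonzero (λ γ → ∑ (filter (λ γ' → ¬? (γ ≟ γ')) nonzero)
                             (λ γ' → P F (β * β') (β * γ' + β' * γ) a b))
      ≡⟨ ∑-cong nonzero inner ⟩
        ∑ nonzero (λ γ → 𝟙 (¬? (w γ ≟ 0#) ×-dec ¬? (γ ≟ w γ)))
      ≡⟨ ∑-filter (λ γ → ¬? (γ ≟ 0#)) elements _ ⟩
        ∑ elements (λ γ → 𝟙 (¬? (γ ≟ 0#)) ℤ.* 𝟙 (¬? (w γ ≟ 0#) ×-dec ¬? (γ ≟ w γ)))
      ≡⟨ ∑-cong elements (λ γ → 𝟙-× (¬? (γ ≟ 0#)) (¬? (w γ ≟ 0#) ×-dec ¬? (γ ≟ w γ))) ⟩
        ∑ elements (λ γ → 𝟙 (good? γ)) ∎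
      where open ≡-Reasoning

    Good : Carrier → Set
    Good γ = γ ≢ 0# × (γ ≢ u × (β + β') * γ ≢ D)

    good⇔ : ∀ γ → (γ ≢ 0# × (w γ ≢ 0# × γ ≢ w γ)) ⇔ Good γ
    good⇔ γ = ⇔.refl ×-⇔ (¬-cong-⇔ (w≡0⇔ γ) ×-⇔ ¬-cong-⇔ (fixed⇔ γ))

    count-good : (ps : List Carrier) → Unique ps → (∀ γ → Good γ ⇔ All (γ ≢_) ps) →
      ∑ elements (λ γ → 𝟙 (good? γ)) ≡ + order - + length ps
    count-good ps ups good⇔avoid = trans
      (∑-cong elements (λ γ → 𝟙-cong (⇔.trans (good⇔ γ) (good⇔avoid γ)) (good? γ) (avoids? γ ps)))
      (count-avoiding unique ups (All.tabulate (λ {p} _ → complete p)))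

    D≢0 : a ≢ b → D ≢ 0#
    D≢0 a≢b D≡0 = a≢b (Equivalence.to D≡0⇔ D≡0)

    0≢u : a ≢ b → 0# ≢ u
    0≢u a≢b 0≡u = D≢0 a≢b (trans (sym (Equivalence.from (at-u 0#) 0≡u)) (zeroʳ β'))

    -- β + β' = 0 and a = b: (β + β') γ = 0 = D for all γ, so no γ is good,
    -- i.e. the good γ are those avoiding every element of F.
    none-good : β + β' ≡ 0# → a ≡ b → ∀ γ → Good γ ⇔ All (γ ≢_) elements
    none-good s≡0 a≡b γ = mk⇔
      (λ (_ , _ , sγ≢D) → ⊥-elim (sγ≢D (trans (sum-kills s≡0 γ) (sym (Equivalence.from D≡0⇔ a≡b)))))
      (λ γ∉F → ⊥-elim (All.lookup γ∉F (complete γ) refl))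

    -- β + β' = 0 and a ≠ b: (β + β') γ = 0 ≠ D always, so only 0 and u are forbidden.
    two-forbidden : β + β' ≡ 0# → a ≢ b → ∀ γ → Good γ ⇔ All (γ ≢_) (0# ∷ u ∷ [])
    two-forbidden s≡0 a≢b γ = mk⇔
      (λ (γ≢0 , γ≢u , _) → γ≢0 ∷ γ≢u ∷ [])
      (λ { (γ≢0 ∷ γ≢u ∷ []) → γ≢0 , γ≢u , λ sγ≡D → D≢0 a≢b (trans (sym sγ≡D) (sum-kills s≡0 γ)) })

    -- β + β' ≠ 0 and a = b: D = 0, so both other conditions also say γ ≠ 0.
    one-forbidden : ¬ (β + β' ≡ 0#) → a ≡ b → ∀ γ → Good γ ⇔ All (γ ≢_) (0# ∷ [])
    one-forbidden s≢0 a≡b γ = mk⇔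
      (λ (γ≢0 , _ , _) → γ≢0 ∷ [])
      (λ { (γ≢0 ∷ []) → γ≢0
                      , (λ γ≡u → γ≢0 (Equivalence.to (mul-zero⇔ β'≢0) (trans (Equivalence.from (at-u γ) γ≡u) D≡0)))
                      , (λ sγ≡D → γ≢0 (Equivalence.to (mul-zero⇔ s≢0) (trans sγ≡D D≡0))) })
      where
      D≡0 : D ≡ 0#
      D≡0 = Equivalence.from D≡0⇔ a≡b

    module ThreeForbidden (s≢0 : ¬ (β + β' ≡ 0#)) (a≢b : a ≢ b) where
      v : Carrier
      v = inv (β + β') s≢0 * D

      at-v : ∀ γ → ((β + β') * γ ≡ D ⇔ γ ≡ v)
      at-v γ = divide⇔ s≢0

      distinct : Unique (0# ∷ u ∷ v ∷ [])
      distinct = (0≢u a≢b ∷ 0≢v ∷ []) ∷ (u≢v ∷ []) ∷ [] ∷ []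
        where
        0≢v : 0# ≢ v
        0≢v 0≡v = D≢0 a≢b (trans (sym (Equivalence.from (at-v 0#) 0≡v)) (zeroʳ (β + β')))
        -- if u = v then β u + β' u = D = β' u, so β u = 0 and u = 0
        u≢v : u ≢ v
        u≢v u≡v = 0≢u a≢b (sym (Equivalence.to (mul-zero⇔ β≢0) (Equivalence.to +-cancel⇔ βu+β'u≡0+β'u)))
          where
          βu+β'u≡0+β'u : β * u + β' * u ≡ 0# + β' * u
          βu+β'u≡0+β'u = trans (sym (distribʳ u β β'))
            (trans (Equivalence.from (at-v u) u≡v)
            (trans (sym (Equivalence.from (at-u u) refl)) (sym (+-identityˡ (β' * u)))))

      three-forbidden : ∀ γ → Good γ ⇔ All (γ ≢_) (0# ∷ u ∷ v ∷ [])
      three-forbidden γ = mk⇔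
        (λ (γ≢0 , γ≢u , sγ≢D) → γ≢0 ∷ γ≢u ∷ (λ γ≡v → sγ≢D (Equivalence.from (at-v γ) γ≡v)) ∷ [])
        (λ { (γ≢0 ∷ γ≢u ∷ γ≢v ∷ []) → γ≢0 , γ≢u , λ sγ≡D → γ≢v (Equivalence.to (at-v γ) sγ≡D) })

    Id-diag : a ≡ b → Id F a b ≡ + 1
    Id-diag a≡b = trans (Id-𝟙 a b) (𝟙-yes a≡b (a ≟ b))

    Id-off : a ≢ b → Id F a b ≡ + 0
    Id-off a≢b = trans (Id-𝟙 a b) (𝟙-no a≢b (a ≟ b))

    entry-sum-zero : β + β' ≡ 0# → Dec (a ≡ b) →
      ∑ elements (λ γ → 𝟙 (good? γ)) ≡ (+ order - + 2) ℤ.* (+ 1 ℤ.+ -[1+ 0 ] ℤ.* Id F a b)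
    entry-sum-zero s≡0 (yes a≡b) =
      trans (count-good elements unique (none-good s≡0 a≡b))
      (trans (q-q (+ order))
             (cong (λ i → (+ order - + 2) ℤ.* (+ 1 ℤ.+ -[1+ 0 ] ℤ.* i)) (sym (Id-diag a≡b))))
      where
      q-q : ∀ q → q - q ≡ (q - + 2) ℤ.* (+ 1 ℤ.+ -[1+ 0 ] ℤ.* + 1)
      q-q = solve-∀
    entry-sum-zero s≡0 (no a≢b) =
      trans (count-good (0# ∷ u ∷ []) ((0≢u a≢b ∷ []) ∷ [] ∷ []) (two-forbidden s≡0 a≢b))
      (trans (q-2 (+ order))
             (cong (λ i → (+ order - + 2) ℤ.* (+ 1 ℤ.+ -[1+ 0 ] ℤ.* i)) (sym (Id-off a≢b))))
      where
      q-2 : ∀ q → q - + 2 ≡ (q - + 2) ℤ.* (+ 1 ℤ.+ -[1+ 0 ] ℤ.* + 0)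
      q-2 = solve-∀

    entry-sum-nonzero : ¬ (β + β' ≡ 0#) → Dec (a ≡ b) →
      ∑ elements (λ γ → 𝟙 (good? γ)) ≡ + 2 ℤ.* Id F a b ℤ.+ (+ order - + 3) ℤ.* + 1
    entry-sum-nonzero s≢0 (yes a≡b) =
      trans (count-good (0# ∷ []) ([] ∷ []) (one-forbidden s≢0 a≡b))
      (trans (q-1 (+ order))
             (cong (λ i → + 2 ℤ.* i ℤ.+ (+ order - + 3) ℤ.* + 1) (sym (Id-diag a≡b))))
      where
      q-1 : ∀ q → q - + 1 ≡ + 2 ℤ.* + 1 ℤ.+ (q - + 3) ℤ.* + 1
      q-1 = solve-∀
    entry-sum-nonzero s≢0 (no a≢b) =
      trans (count-good (0# ∷ u ∷ v ∷ []) distinct three-forbidden)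
      (trans (q-3 (+ order))
             (cong (λ i → + 2 ℤ.* i ℤ.+ (+ order - + 3) ℤ.* + 1) (sym (Id-off a≢b))))
      where
      open ThreeForbidden s≢0 a≢b
      q-3 : ∀ q → q - + 3 ≡ + 2 ℤ.* + 0 ℤ.+ (q - + 3) ℤ.* + 1
      q-3 = solve-∀

  part-iv-zero : ∀ β β' → β ≢ 0# → β' ≢ 0# → β + β' ≡ 0# →
    _≐_ F (ΣM F nonzero (λ γ → ΣM F (filter (λ γ' → ¬? (γ ≟ γ')) nonzero)
             (λ γ' → P F (β * β') (β * γ' + β' * γ))))
          (_⊛_ F (+ order - + 2) (_⊕_ F (Jm F) (_⊛_ F -[1+ 0 ] (Id F))))
  part-iv-zero β β' β≢0 β'≢0 s≡0 a b = trans double-sum (entry-sum-zero s≡0 (a ≟ b))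
    where open PairCount β β' β≢0 β'≢0 a b

  part-iv-nonzero : ∀ β β' → β ≢ 0# → β' ≢ 0# → ¬ (β + β' ≡ 0#) →
    _≐_ F (ΣM F nonzero (λ γ → ΣM F (filter (λ γ' → ¬? (γ ≟ γ')) nonzero)
             (λ γ' → P F (β * β') (β * γ' + β' * γ))))
          (_⊕_ F (_⊛_ F (+ 2) (Id F)) (_⊛_ F (+ order - + 3) (Jm F)))
  part-iv-nonzero β β' β≢0 β'≢0 s≢0 a b = trans double-sum (entry-sum-nonzero s≢0 (a ≟ b))
    where open PairCount β β' β≢0 β'≢0 a b

lemma2p2 : (F : FiniteField) → let open FiniteField F in
    -- (i)
    (∀ β β' γ → ¬ (β ≡ 0#) → ¬ (β' ≡ 0#) →
      _≐_ F (P F (β * β') (γ * β')) (P F β γ))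
    ×
    -- (ii)
    (∀ β β' γ γ' → ¬ (β ≡ 0#) → ¬ (β' ≡ 0#) →
      _≐_ F (_·_ F (P F β γ) (P F β' γ')) (P F (β * β') (β * γ' + β' * γ)))
    ×
    -- (iii)
    (∀ β β' → ¬ (β ≡ 0#) → ¬ (β' ≡ 0#) →
      (β + β' ≡ 0# →
        _≐_ F (ΣM F elements (λ γ → P F (β * β') ((β + β') * γ))) (_⊛_ F (+ order) (Id F)))
      ×
      (¬ (β + β' ≡ 0#) →
        _≐_ F (ΣM F elements (λ γ → P F (β * β') ((β + β') * γ))) (Jm F)))
    ×
    -- (iv)
    (∀ β β' → ¬ (β ≡ 0#) → ¬ (β' ≡ 0#) →
      (β + β' ≡ 0# →
        _≐_ F (ΣM F nonzero (λ γ → ΣM F (filter (λ γ' → ¬? (γ ≟ γ')) nonzero)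
                 (λ γ' → P F (β * β') (β * γ' + β' * γ))))
              (_⊛_ F (+ order - + 2) (_⊕_ F (Jm F) (_⊛_ F -[1+ 0 ] (Id F)))))
      ×
      (¬ (β + β' ≡ 0#) →
        _≐_ F (ΣM F nonzero (λ γ → ΣM F (filter (λ γ' → ¬? (γ ≟ γ')) nonzero)
                 (λ γ' → P F (β * β') (β * γ' + β' * γ))))
              (_⊕_ F (_⊛_ F (+ 2) (Id F)) (_⊛_ F (+ order - + 3) (Jm F)))))
lemma2p2 F =
  part-i ,
  part-ii ,
  (λ β β' β≢0 β'≢0 → part-iii-zero β β' β≢0 β'≢0 , part-iii-nonzero β β' β≢0 β'≢0) ,
  (λ β β' β≢0 β'≢0 → part-iv-zero β β' β≢0 β'≢0 , part-iv-nonzero β β' β≢0 β'≢0)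
  where open PMatrices F
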